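{- Let $f : \mathbf{FIN}_k \to \mathbb{N}$ be given by $f(p) = \max\{n < \omega : p(n) = k\}$, and let $F : \mathcal{P}(\mathbf{FIN}_k) \to \mathbb{N} \cup \{\infty\}$ be given by $F(X) = \sup_{p \in X} f(p)$. Then: (1) for all $P,Q \in \mathbf{FIN}_k^{[\infty]}$, $F(\langle P \rangle \cap \langle Q \rangle) < \infty$ if and only if $P$ and $Q$ are almost disjoint; (2) for all $X_0, X_1, \dots \in \mathcal{P}(\mathbf{FIN}_k)$, $F\left(\bigcup_{n<\omega} X_n\right) = \sup_{n<\omega} F(X_n)$.
   Context: Fix an integer $k \geq 1$. $\mathbf{FIN}_k$ is the set of all maps $p : \omega \to \{0,\dots,k\}$ whose support $\mathrm{supp}(p) = \{n : p(n) \neq 0\}$ is finite and such that $k \in \mathrm{ran}(p)$. For $p,q$ with disjoint supports, $p+q$ is the map equal to $p$ on $\mathrm{supp}(p)$, to $q$ on $\mathrm{supp}(q)$, and $0$ elsewhere. The tetris operation is $T(p)(n) = \max\{p(n)-1,0\}$. Write $p < q$ if $\max\mathrm{supp}(p) < \min\mathrm{supp}(q)$. $\mathbf{FIN}_k^{[\infty]}$ is the set of infinite block sequences $P = (p_n)_{n<\omega}$ in $\mathbf{FIN}_k$ with $p_n < p_{n+1}$ for all $n$. For such $P$, $\langle P \rangle$ is the set of all $T^{j_0}(p_{n_0}) + \cdots + T^{j_m}(p_{n_m})$ with $m<\omega$, $n_0 < \cdots < n_m$, $j_0,\dots,j_m < k$ and $\min_i j_i = 0$. A set $X \subseteq \mathbf{FIN}_k$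 is small if there is no $R \in \mathbf{FIN}_k^{[\infty]}$ with $\langle R \rangle \subseteq X$. $P,Q \in \mathbf{FIN}_k^{[\infty]}$ are almost disjoint if $\langle P \rangle \cap \langle Q \rangle$ is small. The supremum of the empty set is taken as $0$ (or any fixed finite value). -}

module Defs where

open import Data.Nat using (ℕ; zero; suc; _+_; _∸_; _≤_; _<_; _≡ᵇ_)
open import Data.Nat.Properties using ()
open import Data.Bool using (if_then_else_)
open import Data.List using (List; map)
open import Data.Nat.ListAction using (sum)
open import Data.List.Relation.Unary.All using (All)
open import Data.List.Relation.Unary.Any using (Any)
open import Data.List.Relation.Unary.Linked using (Linked)
open import Data.Product using (Σ; ∃; _×_; _,_; proj₁; proj₂)
open import Relation.Binary.PropositionalEquality using (_≡_; _≢_)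
open import Relation.Nullary using (¬_)

record FIN (k : ℕ) : Set where
  field
    fn     : ℕ → ℕ
    bnd    : ℕ
    vals≤  : ∀ n → fn n ≤ k
    supp   : ∀ n → bnd ≤ n → fn n ≡ 0
    hasK   : ∃ λ n → fn n ≡ k
open FIN public

_≺_ : ∀ {k} → FIN k → FIN k → Set
p ≺ q = ∀ i j → fn p i ≢ 0 → fn q j ≢ 0 → i < j

record Block (k : ℕ) : Set where
  field
    seq     : ℕ → FIN k
    ordered : ∀ n → seq n ≺ seq (suc n)
open Block public

Subset : ℕ → Set₁
Subset k = FIN k → Set

_∩_ : ∀ {k} → Subset k → Subset k → Subset k
(X ∩ Y) p = X p × Y p

_⊆_ : ∀ {k} → Subset k → Subset k → Set
X ⊆ Y = ∀ p → X p → Y p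

⋃ : ∀ {k} → (ℕ → Subset k) → Subset k
⋃ X p = ∃ λ n → X n p

-- A combination T^{j_0}(p_{n_0}) + ... + T^{j_m}(p_{n_m}) is coded by the
-- nonempty list of pairs (n_i , j_i).  Since T^j(q)(x) = q(x) ∸ j and the
-- p_{n_i} have pairwise disjoint supports, the value of the sum at x is the
-- sum over the list of (p_{n_i}(x) ∸ j_i).
evalComb : ∀ {k} → Block k → List (ℕ × ℕ) → ℕ → ℕ
evalComb P l x = sum (map (λ nj → fn (seq P (proj₁ nj)) x ∸ proj₂ nj) l)

record ValidComb (k : ℕ) (l : List (ℕ × ℕ)) : Set where
  field
    increasing : Linked (λ a b → proj₁ a < proj₁ b) l
    jBound     : All (λ nj → proj₂ nj < k) l
    someZero   : Any (λ nj → proj₂ nj ≡ 0) l            -- min j_i = 0 (also forces l nonempty)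

⟨_⟩ : ∀ {k} → Block k → Subset k
⟨_⟩ {k} P p = ∃ λ l → ValidComb k l × (∀ x → fn p x ≡ evalComb P l x)

Small : ∀ {k} → Subset k → Set
Small {k} X = ¬ (∃ λ (R : Block k) → ⟨ R ⟩ ⊆ X)

AlmostDisjoint : ∀ {k} → Block k → Block k → Set
AlmostDisjoint P Q = Small (⟨ P ⟩ ∩ ⟨ Q ⟩)

-- max { n < N : g n = k }  (0 if none)
maxBelow : (ℕ → ℕ) → ℕ → ℕ → ℕ
maxBelow g k zero    = 0
maxBelow g k (suc N) = if g N ≡ᵇ k then N else maxBelow g k N

f : ∀ {k} → FIN k → ℕ
f {k} p = maxBelow (fn p) k (bnd p)

-- F(X) = sup_{p ∈ X} f(p) ∈ ℕ ∪ {∞}, described through its relations: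
-- F(X) ≤ b  (b finite)
F≤ : ∀ {k} → Subset k → ℕ → Set
F≤ X b = ∀ p → X p → f p ≤ b

F≡∞ : ∀ {k} → Subset k → Set
F≡∞ X = ∀ B → ∃ λ p → X p × B < f p

F<∞ : ∀ {k} → Subset k → Set
F<∞ X = ¬ F≡∞ X

{-# OPTIONS --safe #-}
module Submission where

-- Part (2) only unfolds the supremum.  For (1): if ⟨R⟩ ⊆ X then f(r_n) ≥ n, so F(X) < ∞
-- makes X small.  Conversely let X = ⟨P⟩ ∩ ⟨Q⟩ with F(X) = ∞.  By induction on N, X has
-- elements vanishing below N with arbitrarily large f; choosing them with successively
-- disjoint supports gives a block sequence R whose blocks lie in ⟨P⟩ and in ⟨Q⟩, and then
-- ⟨R⟩ ⊆ X, since T^j(r_n) expands into shifted blocks T^(i+j)(p_m) of P (resp. Q).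
--
-- For the induction step take members p_0, …, p_{k+1} vanishing below N with f increasing;
-- two of them, p_i and p_j with i < j, agree at N.  Call y a cut of p_j if no term T^c(p_m)
-- of its expansions over P and over Q meets both [0, y] and (y, ∞).  If p_j has a cut y
-- with N ≤ y < f(p_j), then p_j restricted to (y, ∞) is again in X and is as required.
-- Otherwise agreement propagates from N to f(p_j): a term straddling y is recognised in p_i
-- from the common values up to y, and it alone determines both at y + 1.  Then
-- p_i(f(p_j)) = k, so f(p_j) ≤ f(p_i), contradicting i < j.

open import Defs
open import Data.Nat using (ℕ; zero; suc; _+_; _∸_; _≤_; _<_; _≡ᵇ_; z≤n; s≤s; s≤s⁻¹; _≟_; _≤?_; _<?_)
open import Data.Nat.Properties
open import Data.Nat.ListAction using (sum)
open import Data.Nat.ListAction.Properties using (sum-++)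
open import Data.Bool using (true; false; T)
open import Data.Fin using (Fin; toℕ; fromℕ<)
open import Data.Fin.Properties using (pigeonhole; toℕ-fromℕ<)
open import Data.List using (List; []; _∷_; _++_; map; filter; concatMap)
open import Data.List.Properties using (map-++; map-∘; map-cong)
open import Data.List.Relation.Unary.All as All using (All; []; _∷_)
import Data.List.Relation.Unary.All.Properties as All
open import Data.List.Relation.Unary.Any as Any using (Any; here; there)
open import Data.List.Relation.Unary.AllPairs as AllPairs using (AllPairs; []; _∷_)
import Data.List.Relation.Unary.AllPairs.Properties as AllPairs
open import Data.List.Relation.Unary.Linked using ([-])
import Data.List.Relation.Unary.Linked.Properties as Linked
open import Data.List.Membership.Propositional using (_∈_; find; lose)
open import Data.List.Membership.Propositional.Properties using (∈-map⁺; ∈-filter⁺; ∈-concat⁺′)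
open import Data.Product using (∃; _×_; _,_; proj₁; proj₂)
open import Data.Sum using (_⊎_; inj₁; inj₂)
open import Data.Empty using (⊥-elim)
open import Function using (_∘_)
open import Function.Bundles using (_⇔_; mk⇔)
open import Relation.Binary using (tri<; tri≈; tri>)
open import Relation.Binary.PropositionalEquality
open import Relation.Nullary using (¬_; Dec; yes; no)
open import Relation.Nullary.Decidable using (¬?; _×-dec_; map′; decidable-stable)
open import Relation.Unary using (Decidable)

≡k⇒≢0 : ∀ {k v} → 1 ≤ k → v ≡ k → v ≢ 0
≡k⇒≢0 k≥1 v≡k v≡0 = <⇒≢ k≥1 (trans (sym v≡0) v≡k)

≡0⇒∸≡0 : ∀ {v} j → v ≡ 0 → v ∸ j ≡ 0
≡0⇒∸≡0 j refl = 0∸n≡0 j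

∸≡k⇒≡0 : ∀ {k v j} → 1 ≤ k → v ≤ k → v ∸ j ≡ k → j ≡ 0
∸≡k⇒≡0 {v = v} {j} k≥1 v≤k eq =
  ∸-cancelˡ-≡ (<⇒≤ (m∸n≢0⇒n<m (≡k⇒≢0 k≥1 eq))) z≤n
    (≤-antisym (m∸n≤m v j) (≤-trans v≤k (≤-reflexive (sym eq))))

sum-map-zero : ∀ {A : Set} (g : A → ℕ) {l} → All (λ e → g e ≡ 0) l → sum (map g l) ≡ 0
sum-map-zero g []       = refl
sum-map-zero g (z ∷ zs) = cong₂ _+_ z (sum-map-zero g zs)

sum-map-filter : ∀ {A : Set} {D : A → Set} (D? : Decidable D) (g : A → ℕ) {l} →
                 (∀ {e} → e ∈ l → ¬ D e → g e ≡ 0) → sum (map g (filter D? l)) ≡ sum (map g l)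
sum-map-filter D? g {[]}    _     = refl
sum-map-filter D? g {e ∷ l} ¬D⇒≡0 with D? e
... | yes _  = cong (g e +_) (sum-map-filter D? g (¬D⇒≡0 ∘ there))
... | no ¬De = trans (sum-map-filter D? g (¬D⇒≡0 ∘ there))
                     (cong (_+ sum (map g l)) (sym (¬D⇒≡0 (here refl) ¬De)))

sum-map-∸ : ∀ {A : Set} (g : A → ℕ) j {l} → AllPairs (λ a b → g a ≡ 0 ⊎ g b ≡ 0) l →
            sum (map g l) ∸ j ≡ sum (map (λ e → g e ∸ j) l)
sum-map-∸ g j []               = 0∸n≡0 j
sum-map-∸ g j {e ∷ l} (h ∷ hs) with g e ≟ 0
... | yes ge≡0 rewrite ge≡0 =
  trans (sum-map-∸ g j hs) (cong (_+ sum (map (λ e → g e ∸ j) l)) (sym (0∸n≡0 j)))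
... | no  ge≢0 = begin
  (g e + sum (map g l)) ∸ j              ≡⟨ cong (λ s → (g e + s) ∸ j) (sum-map-zero g rest≡0) ⟩
  (g e + 0) ∸ j                          ≡⟨ cong (_∸ j) (+-identityʳ (g e)) ⟩
  g e ∸ j                                ≡⟨ +-identityʳ (g e ∸ j) ⟨
  g e ∸ j + 0                            ≡⟨ cong (g e ∸ j +_) (sum-map-zero _ (All.map (≡0⇒∸≡0 j) rest≡0)) ⟨
  g e ∸ j + sum (map (λ e → g e ∸ j) l)  ∎
  where
    open ≡-Reasoning
    rest≡0 : All (λ a → g a ≡ 0) l
    rest≡0 = All.map (λ { (inj₁ ge≡0) → ⊥-elim (ge≢0 ge≡0) ; (inj₂ ga≡0) → ga≡0 }) h

sum-map-concatMap : ∀ {A B : Set} (h : A → List B) (g : B → ℕ) l →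
                    sum (map g (concatMap h l)) ≡ sum (map (λ e → sum (map g (h e))) l)
sum-map-concatMap h g []      = refl
sum-map-concatMap h g (e ∷ l) = begin
  sum (map g (h e ++ concatMap h l))               ≡⟨ cong sum (map-++ g (h e) (concatMap h l)) ⟩
  sum (map g (h e) ++ map g (concatMap h l))       ≡⟨ sum-++ (map g (h e)) (map g (concatMap h l)) ⟩
  sum (map g (h e)) + sum (map g (concatMap h l))  ≡⟨ cong (sum (map g (h e)) +_) (sum-map-concatMap h g l) ⟩
  sum (map g (h e)) + sum (map (λ e → sum (map g (h e))) l) ∎
  where open ≡-Reasoning

witness : ∀ {k} → FIN k → ℕ
witness p = proj₁ (hasK p)

witness-≢0 : ∀ {k} → 1 ≤ k → (p : FIN k) → fn p (witness p) ≢ 0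
witness-≢0 k≥1 p = ≡k⇒≢0 k≥1 (proj₂ (hasK p))

≢0⇒<bnd : ∀ {k} (p : FIN k) {x} → fn p x ≢ 0 → x < bnd p
≢0⇒<bnd p px≢0 = ≰⇒> (λ bnd≤x → px≢0 (supp p _ bnd≤x))

maxBelow-≥ : (g : ℕ → ℕ) (k m N : ℕ) → g m ≡ k → m < N → m ≤ maxBelow g k N
maxBelow-≥ g k m (suc N) gm≡k m<1+N with g N ≡ᵇ k in eq | m<1+n⇒m<n∨m≡n m<1+N
... | true  | _         = s≤s⁻¹ m<1+N
... | false | inj₁ m<N  = maxBelow-≥ g k m N gm≡k m<N
... | false | inj₂ refl = ⊥-elim (subst T eq (≡⇒≡ᵇ (g m) k gm≡k))

maxBelow-hit : (g : ℕ → ℕ) (k m N : ℕ) → g m ≡ k → m < N → g (maxBelow g k N) ≡ k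
maxBelow-hit g k m (suc N) gm≡k m<1+N with g N ≡ᵇ k in eq | m<1+n⇒m<n∨m≡n m<1+N
... | true  | _         = ≡ᵇ⇒≡ (g N) k (subst T (sym eq) _)
... | false | inj₁ m<N  = maxBelow-hit g k m N gm≡k m<N
... | false | inj₂ refl = ⊥-elim (subst T eq (≡⇒≡ᵇ (g m) k gm≡k))

module _ {k : ℕ} (k≥1 : 1 ≤ k) where

  f-≥ : (p : FIN k) (x : ℕ) → fn p x ≡ k → x ≤ f p
  f-≥ p x px≡k = maxBelow-≥ (fn p) k x (bnd p) px≡k (≢0⇒<bnd p (≡k⇒≢0 k≥1 px≡k))

  f-hit : (p : FIN k) → fn p (f p) ≡ k
  f-hit p = maxBelow-hit (fn p) k (witness p) (bnd p) (proj₂ (hasK p)) (≢0⇒<bnd p (witness-≢0 k≥1 p))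

AgreeUpTo : ∀ {k} → FIN k → FIN k → ℕ → Set
AgreeUpTo p p′ M = ∀ x → x ≤ M → fn p x ≡ fn p′ x

VanishesBelow : ∀ {k} → ℕ → FIN k → Set
VanishesBelow N p = ∀ x → x < N → fn p x ≡ 0

agree-suc : ∀ {k} {p p′ : FIN k} {M} → AgreeUpTo p p′ M → fn p (suc M) ≡ fn p′ (suc M) →
            AgreeUpTo p p′ (suc M)
agree-suc agree eq x x≤1+M with m≤n⇒m<n∨m≡n x≤1+M
... | inj₁ x<1+M = agree x (s≤s⁻¹ x<1+M)
... | inj₂ refl  = eq

agree-at-start : ∀ {k} {p p′ : FIN k} {N} → VanishesBelow N p → VanishesBelow N p′ →
                 fn p N ≡ fn p′ N → AgreeUpTo p p′ N
agree-at-start van van′ eq x x≤N with m≤n⇒m<n∨m≡n x≤N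
... | inj₁ x<N  = trans (van x x<N) (sym (van′ x x<N))
... | inj₂ refl = eq

dropUpToFn : ℕ → (ℕ → ℕ) → ℕ → ℕ
dropUpToFn y g x with x ≤? y
... | yes _ = 0
... | no  _ = g x

dropUpToFn-≤ : ∀ y g {x} → x ≤ y → dropUpToFn y g x ≡ 0
dropUpToFn-≤ y g {x} x≤y with x ≤? y
... | yes _   = refl
... | no  x≰y = ⊥-elim (x≰y x≤y)

dropUpToFn-> : ∀ y g {x} → y < x → dropUpToFn y g x ≡ g x
dropUpToFn-> y g {x} y<x with x ≤? y
... | yes x≤y = ⊥-elim (<⇒≱ y<x x≤y)
... | no  _   = refl

dropUpToFn-≤g : ∀ y g x → dropUpToFn y g x ≤ g x
dropUpToFn-≤g y g x with x ≤? y
... | yes _ = z≤n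
... | no  _ = ≤-refl

dropUpTo : ∀ {k} (y : ℕ) (p : FIN k) → (∃ λ x → y < x × fn p x ≡ k) → FIN k
dropUpTo y p (x₀ , y<x₀ , px₀≡k) = record
  { fn    = dropUpToFn y (fn p)
  ; bnd   = bnd p
  ; vals≤ = λ x → ≤-trans (dropUpToFn-≤g y (fn p) x) (vals≤ p x)
  ; supp  = λ x bnd≤x → n≤0⇒n≡0 (≤-trans (dropUpToFn-≤g y (fn p) x) (≤-reflexive (supp p x bnd≤x)))
  ; hasK  = x₀ , trans (dropUpToFn-> y (fn p) y<x₀) px₀≡k
  }

entry : ∀ {k} → Block k → ℕ → ℕ → ℕ
entry P n x = fn (seq P n) x

term : ∀ {k} → Block k → ℕ × ℕ → ℕ → ℕ
term P e x = entry P (proj₁ e) x ∸ proj₂ e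

term-vanish : ∀ {k} (P : Block k) e {x} → entry P (proj₁ e) x ≡ 0 → term P e x ≡ 0
term-vanish P e = ≡0⇒∸≡0 (proj₂ e)

term≢0⇒entry≢0 : ∀ {k} (P : Block k) e {x} → term P e x ≢ 0 → entry P (proj₁ e) x ≢ 0
term≢0⇒entry≢0 P e t≢0 = t≢0 ∘ term-vanish P e

InHull : ∀ {k} → Block k → ℕ → ℕ → Set
InHull P n x = (∃ λ a → a ≤ x × entry P n a ≢ 0) × (∃ λ b → x ≤ b × entry P n b ≢ 0)

Increasing : List (ℕ × ℕ) → Set
Increasing = AllPairs (λ e e′ → proj₁ e < proj₁ e′)

increasing : ∀ {k l} → ValidComb k l → Increasing l
increasing v = Linked.Linked⇒AllPairs <-trans (ValidComb.increasing v)

-- T^j of a combination: the terms with i + j ≥ k vanish and are dropped.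
tetrisComb : ℕ → ℕ → List (ℕ × ℕ) → List (ℕ × ℕ)
tetrisComb k j l = map (λ e → proj₁ e , proj₂ e + j) (filter (λ e → proj₂ e + j <? k) l)

tetrisComb-All : ∀ {k j l} {Q : ℕ → Set} → All (Q ∘ proj₁) l → All (Q ∘ proj₁) (tetrisComb k j l)
tetrisComb-All all = All.map⁺ (All.filter⁺ _ all)

tetrisComb-increasing : ∀ {k j l} → Increasing l → Increasing (tetrisComb k j l)
tetrisComb-increasing inc = AllPairs.map⁺ (AllPairs.filter⁺ _ inc)

tetrisComb-bounded : ∀ k j l → All (λ e → proj₂ e < k) (tetrisComb k j l)
tetrisComb-bounded k j l = All.map⁺ (All.all-filter _ l)

module _ {k : ℕ} (k≥1 : 1 ≤ k) (P : Block k) where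

  ordered-< : ∀ {m n} → m < n → seq P m ≺ seq P n
  ordered-< {m} {suc n} m<1+n with m<1+n⇒m<n∨m≡n m<1+n
  ... | inj₂ refl = ordered P m
  ... | inj₁ m<n  = λ i j pᵢ≢0 pⱼ≢0 →
    <-trans (ordered-< m<n i w pᵢ≢0 (witness-≢0 k≥1 (seq P n)))
            (ordered P n w j (witness-≢0 k≥1 (seq P n)) pⱼ≢0)
    where w = witness (seq P n)

  witness-<⇒< : ∀ {m n} → witness (seq P m) < witness (seq P n) → m < n
  witness-<⇒< {m} {n} w<w with <-cmp m n
  ... | tri< m<n _ _  = m<n
  ... | tri≈ _ refl _ = ⊥-elim (<-irrefl refl w<w)
  ... | tri> _ _ n<m  = ⊥-elim (<-asym w<w
                          (ordered-< n<m _ _ (witness-≢0 k≥1 (seq P n)) (witness-≢0 k≥1 (seq P m))))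

  inHull-self : ∀ {n x} → entry P n x ≢ 0 → InHull P n x
  inHull-self {x = x} ≢0 = (x , ≤-refl , ≢0) , (x , ≤-refl , ≢0)

  vanish-in-hull : ∀ {m n x} → m ≢ n → InHull P n x → entry P m x ≡ 0
  vanish-in-hull {m} {n} {x} m≢n ((a , a≤x , pa≢0) , (b , x≤b , pb≢0)) with entry P m x ≟ 0
  ... | yes ≡0 = ≡0
  ... | no  ≢0 with <-cmp m n
  ...   | tri< m<n _ _ = ⊥-elim (<⇒≱ (ordered-< m<n x a ≢0 pa≢0) a≤x)
  ...   | tri≈ _ m≡n _ = ⊥-elim (m≢n m≡n)
  ...   | tri> _ _ n<m = ⊥-elim (<⇒≱ (ordered-< n<m b x pb≢0 ≢0) x≤b)

  evalComb-hull : ∀ {l n j x} → Increasing l → (n , j) ∈ l → InHull P n x →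
                  evalComb P l x ≡ entry P n x ∸ j
  evalComb-hull {_ ∷ l} {x = x} (n< ∷ _) (here refl) hull =
    trans (cong (_ +_) (sum-map-zero (λ e → term P e x)
            (All.map (λ {e} n<m → term-vanish P e (vanish-in-hull (>⇒≢ n<m) hull)) n<)))
          (+-identityʳ _)
  evalComb-hull {e ∷ _} (e< ∷ inc) (there mem) hull =
    cong₂ _+_ (term-vanish P e (vanish-in-hull (<⇒≢ (All.lookup e< mem)) hull))
              (evalComb-hull inc mem hull)

  evalComb-single : ∀ {l n j x} → Increasing l → (n , j) ∈ l → entry P n x ≢ 0 →
                    evalComb P l x ≡ entry P n x ∸ j
  evalComb-single inc mem ≢0 = evalComb-hull inc mem (inHull-self ≢0)

  evalComb-≢0 : ∀ l {x} → evalComb P l x ≢ 0 → Any (λ e → term P e x ≢ 0) l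
  evalComb-≢0 []      ≢0 = ⊥-elim (≢0 refl)
  evalComb-≢0 (e ∷ l) {x} ≢0 with term P e x ≟ 0
  ... | no  t≢0 = here t≢0
  ... | yes t≡0 = there (evalComb-≢0 l (≢0 ∘ cong₂ _+_ t≡0))

  ∈-of-evalComb : ∀ {l n j a} → Increasing l → term P (n , j) a ≢ 0 →
                  evalComb P l a ≡ term P (n , j) a → (n , j) ∈ l
  ∈-of-evalComb {l} {n} {j} inc t≢0 eq with find (evalComb-≢0 l (t≢0 ∘ trans (sym eq)))
  ... | (m , i) , mem , s≢0 with m ≟ n
  ...   | no  m≢n = ⊥-elim (s≢0 (term-vanish P (m , i)
                      (vanish-in-hull m≢n (inHull-self (term≢0⇒entry≢0 P (n , j) t≢0)))))
  ...   | yes refl = subst (λ i → (n , i) ∈ l) i≡j mem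
    where
      i≡j : i ≡ j
      i≡j = ∸-cancelˡ-≡ (<⇒≤ (m∸n≢0⇒n<m s≢0)) (<⇒≤ (m∸n≢0⇒n<m t≢0))
              (trans (sym (evalComb-single inc mem (term≢0⇒entry≢0 P (m , i) s≢0))) eq)

  terms-disjoint : ∀ {l} x → Increasing l → AllPairs (λ a b → term P a x ≡ 0 ⊎ term P b x ≡ 0) l
  terms-disjoint x = AllPairs.map λ {a} {b} → one-vanishes a b
    where
      one-vanishes : ∀ a b → proj₁ a < proj₁ b → term P a x ≡ 0 ⊎ term P b x ≡ 0
      one-vanishes a b a<b with entry P (proj₁ a) x ≟ 0
      ... | yes ≡0 = inj₁ (term-vanish P a ≡0)
      ... | no  ≢0 = inj₂ (term-vanish P b (vanish-in-hull (>⇒≢ a<b) (inHull-self ≢0)))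

  evalComb-tetris : ∀ {l} j x → Increasing l → evalComb P l x ∸ j ≡ evalComb P (tetrisComb k j l) x
  evalComb-tetris {l} j x inc = begin
    evalComb P l x ∸ j                     ≡⟨ sum-map-∸ (λ e → term P e x) j (terms-disjoint x inc) ⟩
    sum (map (λ e → term P e x ∸ j) l)     ≡⟨ cong sum (map-cong (λ e → ∸-+-assoc _ (proj₂ e) j) l) ⟩
    sum (map shifted l)                    ≡⟨ sum-map-filter bounded? shifted vanish ⟨
    sum (map shifted (filter bounded? l))  ≡⟨ cong sum (map-∘ (filter bounded? l)) ⟩
    evalComb P (tetrisComb k j l) x        ∎
    where
      open ≡-Reasoning
      shifted : ℕ × ℕ → ℕ
      shifted e = entry P (proj₁ e) x ∸ (proj₂ e + j)
      bounded? : Decidable (λ e → proj₂ e + j < k)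
      bounded? e = proj₂ e + j <? k
      vanish : ∀ {e} → e ∈ l → ¬ (proj₂ e + j < k) → shifted e ≡ 0
      vanish {e} _ ≮k = m≤n⇒m∸n≡0 (≤-trans (vals≤ (seq P (proj₁ e)) x) (≮⇒≥ ≮k))

  MeetsUpTo : ℕ × ℕ → ℕ → Set
  MeetsUpTo e y = ∃ λ a → a ≤ y × term P e a ≢ 0

  MeetsAbove : ℕ × ℕ → ℕ → Set
  MeetsAbove e y = ∃ λ b → y < b × term P e b ≢ 0

  Straddles : List (ℕ × ℕ) → ℕ → Set
  Straddles l y = Any (λ e → MeetsUpTo e y × MeetsAbove e y) l

  meetsUpTo? : ∀ e y → Dec (MeetsUpTo e y)
  meetsUpTo? e y = map′ (λ (a , a<1+y , t≢0) → a , s≤s⁻¹ a<1+y , t≢0)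
                        (λ (a , a≤y , t≢0) → a , s≤s a≤y , t≢0)
                        (anyUpTo? (λ a → ¬? (term P e a ≟ 0)) (suc y))

  meetsAbove? : ∀ e y → Dec (MeetsAbove e y)
  meetsAbove? e y = map′ (λ (b , _ , meets) → b , meets)
                         (λ (b , meets@(_ , t≢0)) →
                            b , ≢0⇒<bnd (seq P (proj₁ e)) (term≢0⇒entry≢0 P e t≢0) , meets)
                         (anyUpTo? (λ b → (y <? b) ×-dec ¬? (term P e b ≟ 0)) (bnd (seq P (proj₁ e))))

  straddles? : ∀ l y → Dec (Straddles l y)
  straddles? l y = Any.any? (λ e → meetsUpTo? e y ×-dec meetsAbove? e y) l

  straddle-agree : ∀ {p p′ : FIN k} (mp : ⟨ P ⟩ p) (mp′ : ⟨ P ⟩ p′) {y} →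
                   AgreeUpTo p p′ y → Straddles (proj₁ mp′) y → fn p (suc y) ≡ fn p′ (suc y)
  straddle-agree {p} {p′} (l , v , eval) (l′ , v′ , eval′) {y} agree straddle with find straddle
  ... | (n , j) , mem′ , (a , a≤y , ta≢0) , (b , y<b , tb≢0) = begin
    fn p (suc y)          ≡⟨ eval (suc y) ⟩
    evalComb P l (suc y)  ≡⟨ evalComb-hull (increasing v) mem hull ⟩
    entry P n (suc y) ∸ j ≡⟨ evalComb-hull (increasing v′) mem′ hull ⟨
    evalComb P l′ (suc y) ≡⟨ eval′ (suc y) ⟨
    fn p′ (suc y)         ∎
    where
      open ≡-Reasoning
      pa≢0 : entry P n a ≢ 0
      pa≢0 = term≢0⇒entry≢0 P (n , j) ta≢0
      hull : InHull P n (suc y)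
      hull = (a , m≤n⇒m≤1+n a≤y , pa≢0) , (b , y<b , term≢0⇒entry≢0 P (n , j) tb≢0)
      mem : (n , j) ∈ l
      mem = ∈-of-evalComb (increasing v) ta≢0 (begin
        evalComb P l a   ≡⟨ eval a ⟨
        fn p a           ≡⟨ agree a a≤y ⟩
        fn p′ a          ≡⟨ eval′ a ⟩
        evalComb P l′ a  ≡⟨ evalComb-single (increasing v′) mem′ pa≢0 ⟩
        term P (n , j) a ∎)

  dropUpTo-∈ : ∀ {p y} (mp : ⟨ P ⟩ p) → ¬ Straddles (proj₁ mp) y →
               (top : ∃ λ x → y < x × fn p x ≡ k) → ⟨ P ⟩ (dropUpTo y p top)
  dropUpTo-∈ {p} {y} (l , v , eval) ¬straddle (x₀ , y<x₀ , px₀≡k) =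
    filter kept? l , valid , eval-kept
    where
      kept? : Decidable (λ e → ¬ MeetsUpTo e y)
      kept? e = ¬? (meetsUpTo? e y)

      vanish-above : ∀ {e x} → e ∈ l → MeetsUpTo e y → y < x → term P e x ≡ 0
      vanish-above {e} {x} mem up y<x =
        decidable-stable (term P e x ≟ 0) (λ t≢0 → ¬straddle (lose mem (up , x , y<x , t≢0)))

      vanish-upTo : ∀ {e x} → ¬ MeetsUpTo e y → x ≤ y → term P e x ≡ 0
      vanish-upTo {e} {x} ¬up x≤y = decidable-stable (term P e x ≟ 0) (λ t≢0 → ¬up (x , x≤y , t≢0))

      eval-kept : ∀ x → dropUpToFn y (fn p) x ≡ evalComb P (filter kept? l) x
      eval-kept x with x ≤? y
      ... | yes x≤y = sym (sum-map-zero (λ e → term P e x)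
                        (All.map (λ {e} ¬up → vanish-upTo {e} ¬up x≤y) (All.all-filter kept? l)))
      ... | no  x≰y = trans (eval x) (sym (sum-map-filter kept? (λ e → term P e x)
                        (λ {e} mem ¬¬up →
                           vanish-above mem (decidable-stable (meetsUpTo? e y) ¬¬up) (≰⇒> x≰y))))

      top-term : Any (λ e → proj₂ e ≡ 0) (filter kept? l)
      top-term with find (evalComb-≢0 l (≡k⇒≢0 k≥1 (trans (sym (eval x₀)) px₀≡k)))
      ... | e , mem , t≢0 = lose (∈-filter⁺ kept? mem (λ up → t≢0 (vanish-above mem up y<x₀)))
                                 (∸≡k⇒≡0 k≥1 (vals≤ (seq P (proj₁ e)) x₀) term≡k)
        where
          term≡k : term P e x₀ ≡ k
          term≡k = trans (sym (evalComb-single (increasing v) mem (term≢0⇒entry≢0 P e t≢0)))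
                         (trans (sym (eval x₀)) px₀≡k)

      valid : ValidComb k (filter kept? l)
      valid = record
        { increasing = Linked.filter⁺ kept? <-trans (ValidComb.increasing v)
        ; jBound     = All.filter⁺ kept? (ValidComb.jBound v)
        ; someZero   = top-term
        }

module _ {k : ℕ} (k≥1 : 1 ≤ k) (P R : Block k) (R⊆P : ∀ n → ⟨ P ⟩ (seq R n)) where

  combOf : ℕ → List (ℕ × ℕ)
  combOf n = proj₁ (R⊆P n)

  combOf-valid : ∀ n → ValidComb k (combOf n)
  combOf-valid n = proj₁ (proj₂ (R⊆P n))

  combOf-eval : ∀ n x → entry R n x ≡ evalComb P (combOf n) x
  combOf-eval n = proj₂ (proj₂ (R⊆P n))

  expansion : ℕ × ℕ → List (ℕ × ℕ)
  expansion e = tetrisComb k (proj₂ e) (combOf (proj₁ e))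

  flatten : List (ℕ × ℕ) → List (ℕ × ℕ)
  flatten = concatMap expansion

  evalComb-flatten : ∀ l x → evalComb R l x ≡ evalComb P (flatten l) x
  evalComb-flatten l x = begin
    evalComb R l x                                    ≡⟨ cong sum (map-cong expand l) ⟩
    sum (map (λ e → evalComb P (expansion e) x) l)    ≡⟨ sum-map-concatMap expansion (λ e → term P e x) l ⟨
    evalComb P (flatten l) x                          ∎
    where
      open ≡-Reasoning
      expand : ∀ e → term R e x ≡ evalComb P (expansion e) x
      expand (n , j) = trans (cong (_∸ j) (combOf-eval n x))
                             (evalComb-tetris k≥1 P j x (increasing (combOf-valid n)))

  witness-used : ∀ {n e} → e ∈ combOf n → entry R n (witness (seq P (proj₁ e))) ≢ 0
  witness-used {n} {m , i} mem = >⇒≢ (m<n⇒0<n∸m i<k) ∘ trans (sym r≡k∸i)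
    where
      i<k : i < k
      i<k = All.lookup (ValidComb.jBound (combOf-valid n)) mem
      r≡k∸i : entry R n (witness (seq P m)) ≡ k ∸ i
      r≡k∸i = trans (combOf-eval n _)
             (trans (evalComb-single k≥1 P (increasing (combOf-valid n)) mem (witness-≢0 k≥1 (seq P m)))
                    (cong (_∸ i) (proj₂ (hasK (seq P m)))))

  combOf-index-< : ∀ {n₁ n₂ a b} → n₁ < n₂ → a ∈ combOf n₁ → b ∈ combOf n₂ → proj₁ a < proj₁ b
  combOf-index-< n₁<n₂ a∈ b∈ =
    witness-<⇒< k≥1 P (ordered-< k≥1 R n₁<n₂ _ _ (witness-used a∈) (witness-used b∈))

  expansion-< : ∀ {e₁ e₂} → proj₁ e₁ < proj₁ e₂ →
                All (λ a → All (λ b → proj₁ a < proj₁ b) (expansion e₂)) (expansion e₁)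
  expansion-< {e₂ = e₂} n₁<n₂ =
    tetrisComb-All {Q = λ m → All (λ b → m < proj₁ b) (expansion e₂)} (All.tabulate λ a∈ →
      tetrisComb-All (All.tabulate λ b∈ → combOf-index-< n₁<n₂ a∈ b∈))

  flatten-valid : ∀ {l} → ValidComb k l → ValidComb k (flatten l)
  flatten-valid {l} v = record
    { increasing = Linked.AllPairs⇒Linked (AllPairs.concat⁺ expansions-increasing expansions-ordered)
    ; jBound     = All.concat⁺ (All.map⁺ (All.universal (λ e → tetrisComb-bounded k _ (combOf (proj₁ e))) l))
    ; someZero   = untouched-term
    }
    where
      expansions-increasing : All Increasing (map expansion l)
      expansions-increasing =
        All.map⁺ (All.universal (λ e → tetrisComb-increasing (increasing (combOf-valid (proj₁ e)))) l)

      expansions-ordered :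
        AllPairs (λ xs ys → All (λ a → All (λ b → proj₁ a < proj₁ b) ys) xs) (map expansion l)
      expansions-ordered = AllPairs.map⁺ (AllPairs.map expansion-< (increasing v))

      untouched-term : Any (λ e → proj₂ e ≡ 0) (flatten l)
      untouched-term with find (ValidComb.someZero v)
      ... | (n , j) , e∈ , j≡0 with find (ValidComb.someZero (combOf-valid n))
      ... | (m , i) , a∈ , i≡0 =
        lose (∈-concat⁺′ (∈-map⁺ _ (∈-filter⁺ _ a∈ (subst (_< k) (sym i+j≡0) k≥1))) (∈-map⁺ expansion e∈))
             i+j≡0
        where
          i+j≡0 : i + j ≡ 0
          i+j≡0 = cong₂ _+_ i≡0 j≡0

  ⟨⟩-⊆ : ⟨ R ⟩ ⊆ ⟨ P ⟩
  ⟨⟩-⊆ p (l , v , eval) = flatten l , flatten-valid v , λ x → trans (eval x) (evalComb-flatten l x)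

module _ {k : ℕ} (k≥1 : 1 ≤ k) where

  seq-∈-⟨⟩ : (R : Block k) → ∀ n → ⟨ R ⟩ (seq R n)
  seq-∈-⟨⟩ R n = (n , 0) ∷ [] , record { increasing = [-] ; jBound = k≥1 ∷ [] ; someZero = here refl } ,
                 λ x → sym (+-identityʳ _)

  f-seq-< : (R : Block k) → ∀ n → f (seq R n) < f (seq R (suc n))
  f-seq-< R n =
    ordered R n _ _ (≡k⇒≢0 k≥1 (f-hit k≥1 (seq R n))) (≡k⇒≢0 k≥1 (f-hit k≥1 (seq R (suc n))))

  index≤f : (R : Block k) → ∀ n → n ≤ f (seq R n)
  index≤f R zero    = z≤n
  index≤f R (suc n) = ≤-<-trans (index≤f R n) (f-seq-< R n)

  ⟨⟩-F≡∞ : (R : Block k) → F≡∞ ⟨ R ⟩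
  ⟨⟩-F≡∞ R B = seq R (suc B) , seq-∈-⟨⟩ R (suc B) , index≤f R (suc B)

  F<∞⇒Small : (X : Subset k) → F<∞ X → Small X
  F<∞⇒Small X bounded (R , ⟨R⟩⊆X) = bounded λ B →
    let p , r , B<f = ⟨⟩-F≡∞ R B in p , ⟨R⟩⊆X p r , B<f

module _ {k : ℕ} (k≥1 : 1 ≤ k) (P Q : Block k) where

  Cut : (p : FIN k) → (⟨ P ⟩ ∩ ⟨ Q ⟩) p → ℕ → Set
  Cut _ (mP , mQ) y = ¬ Straddles k≥1 P (proj₁ mP) y × ¬ Straddles k≥1 Q (proj₁ mQ) y

  agree-or-cut : ∀ {N} p p′ (xp : (⟨ P ⟩ ∩ ⟨ Q ⟩) p) (xp′ : (⟨ P ⟩ ∩ ⟨ Q ⟩) p′) →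
                 AgreeUpTo p p′ N → ∀ M → AgreeUpTo p p′ M ⊎ ∃ λ y → N ≤ y × y < M × Cut p′ xp′ y
  agree-or-cut p p′ xp xp′ agreeN zero = inj₁ λ x x≤0 → agreeN x (≤-trans x≤0 z≤n)
  agree-or-cut {N} p p′ xp@(mP , mQ) xp′@(mP′ , mQ′) agreeN (suc M)
    with agree-or-cut p p′ xp xp′ agreeN M
  ... | inj₂ (y , N≤y , y<M , cut) = inj₂ (y , N≤y , m<n⇒m<1+n y<M , cut)
  ... | inj₁ agreeM with N ≤? M | straddles? k≥1 P (proj₁ mP′) M | straddles? k≥1 Q (proj₁ mQ′) M
  ...   | no N≰M  | _      | _      = inj₁ λ x x≤1+M → agreeN x (≤-trans x≤1+M (≰⇒> N≰M))
  ...   | yes _   | yes sP | _      =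
    inj₁ (agree-suc {p = p} {p′} agreeM (straddle-agree k≥1 P {p} {p′} mP mP′ agreeM sP))
  ...   | yes _   | no _   | yes sQ =
    inj₁ (agree-suc {p = p} {p′} agreeM (straddle-agree k≥1 Q {p} {p′} mQ mQ′ agreeM sQ))
  ...   | yes N≤M | no ¬sP | no ¬sQ = inj₂ (M , N≤M , ≤-refl , ¬sP , ¬sQ)

  cut⇒tail : ∀ {N y} p (xp : (⟨ P ⟩ ∩ ⟨ Q ⟩) p) → N ≤ y → y < f p → Cut p xp y →
             ∃ λ q → (⟨ P ⟩ ∩ ⟨ Q ⟩) q × f p ≤ f q × VanishesBelow (suc N) q
  cut⇒tail {N} {y} p (mP , mQ) N≤y y<f (¬sP , ¬sQ) =
    q , (dropUpTo-∈ k≥1 P {p} mP ¬sP top , dropUpTo-∈ k≥1 Q {p} mQ ¬sQ top) ,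
    f-≥ k≥1 q (f p) (proj₂ (hasK q)) ,
    λ x x<1+N → dropUpToFn-≤ y (fn p) (≤-trans (s≤s⁻¹ x<1+N) N≤y)
    where
      top : ∃ λ x → y < x × fn p x ≡ k
      top = f p , y<f , f-hit k≥1 p
      q : FIN k
      q = dropUpTo y p top

  TailUnbounded : ℕ → Set
  TailUnbounded N = ∀ B → ∃ λ p → (⟨ P ⟩ ∩ ⟨ Q ⟩) p × B < f p × VanishesBelow N p

  module Chain {N} (tail : TailUnbounded N) (B : ℕ) where

    bound : ℕ → ℕ
    link : ∀ i → ∃ λ p → (⟨ P ⟩ ∩ ⟨ Q ⟩) p × bound i < f p × VanishesBelow N p

    bound zero    = B
    bound (suc i) = f (proj₁ (link i))
    link i = tail (bound i)

    member : ℕ → FIN k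
    member i = proj₁ (link i)

    member-∈ : ∀ i → (⟨ P ⟩ ∩ ⟨ Q ⟩) (member i)
    member-∈ i = proj₁ (proj₂ (link i))

    member-vanishes : ∀ i → VanishesBelow N (member i)
    member-vanishes i = proj₂ (proj₂ (proj₂ (link i)))

    f-member-< : ∀ {i j} → i < j → f (member i) < f (member j)
    f-member-< {i} {suc j} i<1+j with m<1+n⇒m<n∨m≡n i<1+j
    ... | inj₁ i<j  = <-trans (f-member-< i<j) (proj₁ (proj₂ (proj₂ (link (suc j)))))
    ... | inj₂ refl = proj₁ (proj₂ (proj₂ (link (suc i))))

    B<f-member : ∀ i → B < f (member i)
    B<f-member zero    = proj₁ (proj₂ (proj₂ (link zero)))
    B<f-member (suc i) = <-trans (B<f-member i) (f-member-< (n<1+n i))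

    valueAtN : Fin (suc (suc k)) → Fin (suc k)
    valueAtN i = fromℕ< (s≤s (vals≤ (member (toℕ i)) N))

    valueAtN-≡ : ∀ {i j} → valueAtN i ≡ valueAtN j → fn (member (toℕ i)) N ≡ fn (member (toℕ j)) N
    valueAtN-≡ same = trans (sym (toℕ-fromℕ< _)) (trans (cong toℕ same) (toℕ-fromℕ< _))

    extend : ∃ λ q → (⟨ P ⟩ ∩ ⟨ Q ⟩) q × B < f q × VanishesBelow (suc N) q
    extend with pigeonhole (n<1+n (suc k)) valueAtN
    ... | i , j , i<j , same
      with agree-or-cut (member (toℕ i)) (member (toℕ j)) (member-∈ (toℕ i)) (member-∈ (toℕ j))
             (agree-at-start {p = member (toℕ i)} {member (toℕ j)}
               (member-vanishes (toℕ i)) (member-vanishes (toℕ j)) (valueAtN-≡ {i} {j} same))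
             (f (member (toℕ j)))
    ...   | inj₂ (y , N≤y , y<f , cut) =
      let q , xq , f≤ , vanq = cut⇒tail (member (toℕ j)) (member-∈ (toℕ j)) N≤y y<f cut
      in q , xq , <-≤-trans (B<f-member (toℕ j)) f≤ , vanq
    ...   | inj₁ agree = ⊥-elim (<⇒≱ (f-member-< i<j)
                           (f-≥ k≥1 (member (toℕ i)) _ (trans (agree _ ≤-refl) (f-hit k≥1 (member (toℕ j))))))

  tailUnbounded : F≡∞ (⟨ P ⟩ ∩ ⟨ Q ⟩) → ∀ N → TailUnbounded N
  tailUnbounded unbounded zero    B = let p , xp , B<f = unbounded B in p , xp , B<f , λ _ ()
  tailUnbounded unbounded (suc N) B = Chain.extend (tailUnbounded unbounded N) B

  module _ (unbounded : F≡∞ (⟨ P ⟩ ∩ ⟨ Q ⟩)) where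

    start : ℕ → ℕ
    block : ℕ → FIN k

    start zero    = 0
    start (suc i) = bnd (block i)
    block i = proj₁ (tailUnbounded unbounded (start i) 0)

    block-∈ : ∀ i → (⟨ P ⟩ ∩ ⟨ Q ⟩) (block i)
    block-∈ i = proj₁ (proj₂ (tailUnbounded unbounded (start i) 0))

    block-vanishes : ∀ i → VanishesBelow (start i) (block i)
    block-vanishes i = proj₂ (proj₂ (proj₂ (tailUnbounded unbounded (start i) 0)))

    blocks : Block k
    blocks = record
      { seq     = block
      ; ordered = λ i a b aᵢ≢0 bᵢ₊₁≢0 →
          <-≤-trans (≢0⇒<bnd (block i) aᵢ≢0) (≮⇒≥ (bᵢ₊₁≢0 ∘ block-vanishes (suc i) b))
      }

    ⟨blocks⟩-⊆ : ⟨ blocks ⟩ ⊆ (⟨ P ⟩ ∩ ⟨ Q ⟩)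
    ⟨blocks⟩-⊆ p r =
      ⟨⟩-⊆ k≥1 P blocks (proj₁ ∘ block-∈) p r , ⟨⟩-⊆ k≥1 Q blocks (proj₂ ∘ block-∈) p r

  AlmostDisjoint⇒F<∞ : AlmostDisjoint P Q → F<∞ (⟨ P ⟩ ∩ ⟨ Q ⟩)
  AlmostDisjoint⇒F<∞ small unbounded = small (blocks unbounded , ⟨blocks⟩-⊆ unbounded)

F≤-⋃ : ∀ {k} (X : ℕ → Subset k) (b : ℕ) → F≤ (⋃ X) b ⇔ ((n : ℕ) → F≤ (X n) b)
F≤-⋃ X b = mk⇔ (λ bounded n p p∈Xₙ → bounded p (n , p∈Xₙ))
                (λ bounded p (n , p∈Xₙ) → bounded n p p∈Xₙ)

lemma2p1 : (k : ℕ) → 1 ≤ k →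
    ((P Q : Block k) → F<∞ (⟨ P ⟩ ∩ ⟨ Q ⟩) ⇔ AlmostDisjoint P Q)
    × ((X : ℕ → Subset k) → (b : ℕ) → F≤ (⋃ X) b ⇔ ((n : ℕ) → F≤ (X n) b))
lemma2p1 k k≥1 =
  (λ P Q → mk⇔ (F<∞⇒Small k≥1 (⟨ P ⟩ ∩ ⟨ Q ⟩)) (AlmostDisjoint⇒F<∞ k≥1 P Q)) , F≤-⋃
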